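{- For every positive integer $n$, there exists a top-balanced sequence of $n$ permutations of $[n]$; that is, there exist assignments $\sigma_1,\ldots,\sigma_n$ (each a bijection from a set $N$ of $n$ players to the item set $[n]$) such that for every day $t\in[n]$ and every player $i\in N$, $Z_i^t[1]\le \lceil n/t\rceil$.
   Context: There are $n$ players $N=\{A_1,\ldots,A_n\}$ and $n$ items $[n]=\{1,\ldots,n\}$, where item $1$ is the best and item $n$ the worst. A repeated assignment (permutation sequence) is a finite sequence of bijections $\sigma_1,\sigma_2,\ldots$ between $N$ and $[n]$; $\sigma_s$ is the assignment on day $s$. The bundle $Z_i^t$ of player $i$ after day $t$ is the multiset $\{\sigma_1(i),\ldots,\sigma_t(i)\}$. For a multiset $Z$ of items and $k\le |Z|$, $Z[k]$ denotes the $k$-th best item of $Z$, i.e., the $k$-th smallest number in $Z$ (counted with multiplicity). A sequence of $n$ assignments is top-balanced if $Z_i^t[1]\le\lceil n/t\rceil$ for all $t\in[n]$ and all $i\in N$. -}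

module Defs where

open import Data.Nat using (ℕ; zero; suc; _+_; _∸_; _⊓_; _≤_; _<?_; NonZero)
open import Data.Nat.DivMod using (_/_)
open import Data.Fin using (Fin; toℕ)
open import Data.List using (List; []; _∷_; foldr; map; filter; allFin)
open import Function.Bundles using (_⤖_; Bijection)

-- Players N are Fin n (A_1..A_n). Items [n] are Fin n, where the element k
-- stands for item number toℕ k + 1 (item 1 best, item n worst).

Assignment : ℕ → Set
Assignment n = Fin n ⤖ Fin n

-- A sequence of n assignments σ_1..σ_n; σ s is the assignment on day toℕ s + 1.
AssignmentSeq : ℕ → Set
AssignmentSeq n = Fin n → Assignment n

itemOn : ∀ {n} → AssignmentSeq n → Fin n → Fin n → ℕ
itemOn σ s i = suc (toℕ (Bijection.to (σ s) i))

bundle : ∀ {n} → AssignmentSeq n → Fin n → ℕ → List ℕ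
bundle {n} σ i t = map (λ s → itemOn σ s i) (filter (λ s → toℕ s <? t) (allFin n))

-- Z[1]: the best item, i.e. smallest number, of a multiset (given as a list).
-- Only applied to nonempty bundles (t ≥ 1); for an empty list it returns 0.
best : List ℕ → ℕ
best []       = 0
best (x ∷ xs) = foldr _⊓_ x xs

⌈_/_⌉ : ℕ → (t : ℕ) → .{{NonZero t}} → ℕ
⌈ m / t ⌉ = (m + t ∸ 1) / t

TopBalanced : ∀ {n} → AssignmentSeq n → Set
TopBalanced {n} σ = (d : Fin n) (i : Fin n) →
  best (bundle σ i (suc (toℕ d))) ≤ ⌈ n / suc (toℕ d) ⌉

-- After t days, every player holds a distinct position p < n, read in base t
-- as p = b + r·t with b < t, and the invariant is that the player received
-- item r (counting from 0) on day b; since r·t ≤ p < n, its number r + 1 is at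
-- most ⌈n/t⌉.  To pass to t + 1 days, positions are re-read in base t + 1
-- (b + r·t ↦ b + r·(t+1), i.e. p ↦ p + ⌊p/t⌋).  This stays below n for exactly
-- the first n − ⌊n/(t+1)⌋ positions; the other ⌊n/(t+1)⌋ players receive the
-- top items 0, 1, … on the new day t and take the positions t + r·(t+1) that
-- the re-reading leaves free.
module Submission where

open import Defs
open import Data.Nat using (ℕ; NonZero)
open import Data.Product using (∃)

open import Data.Nat
open import Data.Nat.Properties
open import Data.Nat.DivMod
open import Data.Sum using (_⊎_; inj₁; inj₂)
open import Data.Product using (_×_; _,_)
open import Data.Fin using (Fin; toℕ; fromℕ<)
open import Data.Fin.Properties using (toℕ-fromℕ<; toℕ<n; toℕ-injective)
open import Data.Fin.Permutation using (Permutation′; permutation; _⟨$⟩ʳ_; _∘ₚ_; id)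
open import Data.List using ([]; _∷_; foldr)
open import Data.List.Membership.Propositional using (_∈_)
open import Data.List.Membership.Propositional.Properties using (∈-map⁺; ∈-filter⁺; ∈-allFin)
open import Data.List.Relation.Unary.Any using (here; there)
open import Function.Properties.Inverse using (↔⇒⤖)
open import Relation.Binary.PropositionalEquality
open import Relation.Nullary using (yes; no)
open import Relation.Nullary.Negation using (contradiction)
open import Relation.Binary.Definitions using (tri<; tri≈; tri>)

digits-% : ∀ {b B} r .{{_ : NonZero B}} → b < B → (b + r * B) % B ≡ b
digits-% {b} {B} r b<B = trans ([m+kn]%n≡m%n b r B) (m<n⇒m%n≡m b<B)

digits-/ : ∀ {b B} r .{{_ : NonZero B}} → b < B → (b + r * B) / B ≡ r
digits-/ {b} {B} r b<B = sym (*-cancelʳ-≡ r q B (+-cancelˡ-≡ b _ _ (begin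
  b + r * B                ≡⟨ m≡m%n+[m/n]*n (b + r * B) B ⟩
  (b + r * B) % B + q * B  ≡⟨ cong (_+ q * B) (digits-% r b<B) ⟩
  b + q * B                ∎)))
  where
  open ≡-Reasoning
  q = (b + r * B) / B

digits-suc : ∀ b r B → b + r * suc B ≡ b + r * B + r
digits-suc b r B = begin
  b + r * suc B    ≡⟨ cong (b +_) (*-suc r B) ⟩
  b + (r + r * B)  ≡⟨ cong (b +_) (+-comm r (r * B)) ⟩
  b + (r * B + r)  ≡⟨ +-assoc b (r * B) r ⟨
  b + r * B + r    ∎
  where open ≡-Reasoning

digits-<⇒lex : ∀ {b r n₀ c B} → n₀ ≤ B → b + r * B < n₀ + c * B → r < c ⊎ (r ≡ c × b < n₀)
digits-<⇒lex {b} {r} {n₀} {c} {B} n₀≤B lt with <-cmp r c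
... | tri< r<c _ _ = inj₁ r<c
... | tri≈ _ refl _ = inj₂ (refl , +-cancelʳ-< (r * B) b n₀ lt)
... | tri> _ _ c<r = contradiction lt (≤⇒≯ (begin
  n₀ + c * B   ≤⟨ +-monoˡ-≤ (c * B) n₀≤B ⟩
  suc c * B    ≤⟨ *-monoˡ-≤ B c<r ⟩
  r * B        ≤⟨ m≤n+m (r * B) b ⟩
  b + r * B    ∎))
  where open ≤-Reasoning

lex⇒digits-< : ∀ {b r n₀ c B} → b < B → r < c ⊎ (r ≡ c × b < n₀) → b + r * B < n₀ + c * B
lex⇒digits-< {b} {r} {n₀} {c} {B} b<B (inj₁ r<c) = begin-strict
  b + r * B    <⟨ +-monoˡ-< (r * B) b<B ⟩
  suc r * B    ≤⟨ *-monoˡ-≤ B r<c ⟩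
  c * B        ≤⟨ m≤n+m (c * B) n₀ ⟩
  n₀ + c * B   ∎
  where open ≤-Reasoning
lex⇒digits-< {r = r} {B = B} _ (inj₂ (refl , b<n₀)) = +-monoˡ-< (r * B) b<n₀

*-≤⇒≤-/ : ∀ {m n} o .{{_ : NonZero o}} → m * o ≤ n → m ≤ n / o
*-≤⇒≤-/ {m} o le = subst (_≤ _) (m*n/n≡m m o) (/-monoˡ-≤ o le)

≤-/⇒*-≤ : ∀ {m n} o .{{_ : NonZero o}} → m ≤ n / o → m * o ≤ n
≤-/⇒*-≤ {n = n} o le = ≤-trans (*-monoˡ-≤ o le) (m/n*n≤m n o)

module _ {n : ℕ} (f g : ℕ → ℕ)
         (f-< : ∀ {p} → p < n → f p < n) (g-< : ∀ {q} → q < n → g q < n)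
         (g∘f : ∀ {p} → p < n → g (f p) ≡ p) (f∘g : ∀ {q} → q < n → f (g q) ≡ q) where

  permutationℕ : Permutation′ n
  permutationℕ = permutation (λ i → fromℕ< (f-< (toℕ<n i))) (λ j → fromℕ< (g-< (toℕ<n j)))
    (λ j → toℕ-injective (trans (toℕ-fromℕ< _) (trans (cong f (toℕ-fromℕ< _)) (f∘g (toℕ<n j)))))
    (λ i → toℕ-injective (trans (toℕ-fromℕ< _) (trans (cong g (toℕ-fromℕ< _)) (g∘f (toℕ<n i)))))

rotate : ℕ → ℕ → ℕ → ℕ
rotate a b p with p <? a
... | yes _ = p + b
... | no _  = p ∸ a

rotate-≥ : ∀ {a} b {p} → a ≤ p → rotate a b p ≡ p ∸ a
rotate-≥ {a} b {p} a≤p with p <? a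
... | yes p<a = contradiction a≤p (<⇒≱ p<a)
... | no _    = refl

rotate-< : ∀ a b {p} → p < a + b → rotate a b p < a + b
rotate-< a b {p} p<a+b with p <? a
... | yes p<a = +-monoˡ-< b p<a
... | no _    = ≤-<-trans (m∸n≤m p a) p<a+b

rotate-rotate : ∀ a b {p} → p < a + b → rotate b a (rotate a b p) ≡ p
rotate-rotate a b {p} p<a+b with p <? a
... | yes _  = trans (rotate-≥ a (m≤n+m b p)) (m+n∸n≡m p b)
... | no p≮a with p ∸ a <? b
...   | yes _  = m∸n+n≡m (≮⇒≥ p≮a)
...   | no p∸a≮b = contradiction (+-cancelˡ-< a (p ∸ a) b (subst (_< a + b) (sym (m+[n∸m]≡n (≮⇒≥ p≮a))) p<a+b)) p∸a≮b

rotateₚ : ∀ {n} a b → a + b ≡ n → Permutation′ n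
rotateₚ a b a+b≡n = permutationℕ (rotate a b) (rotate b a)
  (λ p<n → subst (_ <_) a+b≡n (rotate-< a b (subst (_ <_) (sym a+b≡n) p<n)))
  (λ q<n → subst (_ <_) b+a≡n (rotate-< b a (subst (_ <_) (sym b+a≡n) q<n)))
  (λ p<n → rotate-rotate a b (subst (_ <_) (sym a+b≡n) p<n))
  (λ q<n → rotate-rotate b a (subst (_ <_) (sym b+a≡n) q<n))
  where b+a≡n = trans (+-comm b a) a+b≡n

widen : (t : ℕ) .{{_ : NonZero t}} → ℕ → ℕ
widen t p = p + p / t

narrow : ℕ → ℕ → ℕ
narrow t q = q ∸ q / suc t

widen-digits : ∀ {b t} r .{{_ : NonZero t}} → b < t → widen t (b + r * t) ≡ b + r * suc t
widen-digits {b} {t} r b<t = begin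
  b + r * t + (b + r * t) / t  ≡⟨ cong (b + r * t +_) (digits-/ r b<t) ⟩
  b + r * t + r                ≡⟨ digits-suc b r t ⟨
  b + r * suc t                ∎
  where open ≡-Reasoning

narrow-digits : ∀ {b t} r → b < suc t → narrow t (b + r * suc t) ≡ b + r * t
narrow-digits {b} {t} r b<1+t = begin
  b + r * suc t ∸ (b + r * suc t) / suc t  ≡⟨ cong (b + r * suc t ∸_) (digits-/ r b<1+t) ⟩
  b + r * suc t ∸ r                        ≡⟨ cong (_∸ r) (digits-suc b r t) ⟩
  b + r * t + r ∸ r                        ≡⟨ m+n∸n≡m (b + r * t) r ⟩
  b + r * t                                ∎
  where open ≡-Reasoning

module Advance (n t : ℕ) .{{_ : NonZero t}} where

  fresh kept leftover : ℕ
  fresh    = n / suc t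
  kept     = n ∸ fresh
  leftover = n % suc t

  n≡digits : n ≡ leftover + fresh * suc t
  n≡digits = m≡m%n+[m/n]*n n (suc t)

  kept≡digits : kept ≡ leftover + fresh * t
  kept≡digits = trans (cong (_∸ fresh) (trans n≡digits (digits-suc leftover fresh t)))
                      (m+n∸n≡m (leftover + fresh * t) fresh)

  kept+fresh≡n : kept + fresh ≡ n
  kept+fresh≡n = m∸n+n≡m (m/n≤m n (suc t))

  leftover≤t : leftover ≤ t
  leftover≤t = s≤s⁻¹ (m%n<n n (suc t))

  <kept⇒widened<n : ∀ {b} r → b < t → b + r * t < kept → b + r * suc t < n
  <kept⇒widened<n {b} r b<t lt = subst (b + r * suc t <_) (sym n≡digits)
    (lex⇒digits-< {r = r} (m<n⇒m<1+n b<t)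
      (digits-<⇒lex {r = r} {c = fresh} {B = t} leftover≤t (subst (b + r * t <_) kept≡digits lt)))

  widened<n⇒<kept : ∀ {b} r → b < t → b + r * suc t < n → b + r * t < kept
  widened<n⇒<kept {b} r b<t lt = subst (b + r * t <_) (sym kept≡digits)
    (lex⇒digits-< {r = r} b<t
      (digits-<⇒lex {r = r} {c = fresh} {B = suc t} (m≤n⇒m≤1+n leftover≤t) (subst (b + r * suc t <_) n≡digits lt)))

  widen≡digits : ∀ p → widen t p ≡ p % t + p / t * suc t
  widen≡digits p = trans (cong (widen t) (m≡m%n+[m/n]*n p t)) (widen-digits (p / t) (m%n<n p t))

  widen-< : ∀ {p} → p < kept → widen t p < n
  widen-< {p} p<kept = subst (_< n) (sym (widen≡digits p))
    (<kept⇒widened<n (p / t) (m%n<n p t) (subst (_< kept) (m≡m%n+[m/n]*n p t) p<kept))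

  ∸kept<fresh : ∀ {p} → kept ≤ p → p < n → p ∸ kept < fresh
  ∸kept<fresh {p} kept≤p p<n = +-cancelˡ-< kept (p ∸ kept) fresh
    (subst₂ _<_ (sym (m+[n∸m]≡n kept≤p)) (sym kept+fresh≡n) p<n)

  advance : ℕ → ℕ
  advance p with p <? kept
  ... | yes _ = widen t p
  ... | no _  = t + (p ∸ kept) * suc t

  retreat : ℕ → ℕ
  retreat q with q % suc t ≟ t
  ... | yes _ = kept + q / suc t
  ... | no _  = narrow t q

  advance-kept : ∀ {p} → p < kept → advance p ≡ widen t p
  advance-kept {p} p<kept with p <? kept
  ... | yes _      = refl
  ... | no p≮kept  = contradiction p<kept p≮kept

  advance-fresh : ∀ {p} → kept ≤ p → advance p ≡ t + (p ∸ kept) * suc t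
  advance-fresh {p} kept≤p with p <? kept
  ... | yes p<kept = contradiction kept≤p (<⇒≱ p<kept)
  ... | no _       = refl

  retreat-fresh : ∀ q → q % suc t ≡ t → retreat q ≡ kept + q / suc t
  retreat-fresh q q%≡t with q % suc t ≟ t
  ... | yes _  = refl
  ... | no q%≢t = contradiction q%≡t q%≢t

  retreat-kept : ∀ q → q % suc t ≢ t → retreat q ≡ narrow t q
  retreat-kept q q%≢t with q % suc t ≟ t
  ... | yes q%≡t = contradiction q%≡t q%≢t
  ... | no _     = refl

  advance-< : ∀ {p} → p < n → advance p < n
  advance-< {p} p<n with p <? kept
  ... | yes p<kept = widen-< p<kept
  ... | no p≮kept  = ≤-/⇒*-≤ (suc t) (∸kept<fresh (≮⇒≥ p≮kept) p<n)

  retreat-< : ∀ {q} → q < n → retreat q < n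
  retreat-< {q} q<n with q % suc t ≟ t
  ... | yes q%≡t = subst (kept + q / suc t <_) kept+fresh≡n (+-monoʳ-< kept (*-≤⇒≤-/ (suc t) q<n′))
    where
    q<n′ : t + q / suc t * suc t < n
    q<n′ = subst (_< n) (trans (m≡m%n+[m/n]*n q (suc t)) (cong (_+ q / suc t * suc t) q%≡t)) q<n
  ... | no _     = ≤-<-trans (m∸n≤m q (q / suc t)) q<n

  retreat-advance : ∀ {p} → p < n → retreat (advance p) ≡ p
  retreat-advance {p} p<n with p <? kept
  ... | yes _ = begin
    retreat (widen t p)                  ≡⟨ cong retreat (widen≡digits p) ⟩
    retreat (p % t + p / t * suc t)
      ≡⟨ retreat-kept (p % t + p / t * suc t) (λ eq → <⇒≢ (m%n<n p t) (trans (sym digits%) eq)) ⟩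
    narrow t (p % t + p / t * suc t)     ≡⟨ narrow-digits (p / t) (m<n⇒m<1+n (m%n<n p t)) ⟩
    p % t + p / t * t                    ≡⟨ m≡m%n+[m/n]*n p t ⟨
    p                                    ∎
    where
    open ≡-Reasoning
    digits% : (p % t + p / t * suc t) % suc t ≡ p % t
    digits% = digits-% (p / t) (m<n⇒m<1+n (m%n<n p t))
  ... | no p≮kept = begin
    retreat (t + (p ∸ kept) * suc t)
      ≡⟨ retreat-fresh (t + (p ∸ kept) * suc t) (digits-% (p ∸ kept) (n<1+n t)) ⟩
    kept + (t + (p ∸ kept) * suc t) / suc t  ≡⟨ cong (kept +_) (digits-/ (p ∸ kept) (n<1+n t)) ⟩
    kept + (p ∸ kept)                        ≡⟨ m+[n∸m]≡n (≮⇒≥ p≮kept) ⟩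
    p                                        ∎
    where open ≡-Reasoning

  advance-retreat : ∀ {q} → q < n → advance (retreat q) ≡ q
  advance-retreat {q} q<n with q % suc t ≟ t
  ... | yes q%≡t = begin
    advance (kept + q / suc t)             ≡⟨ advance-fresh (m≤m+n kept _) ⟩
    t + (kept + q / suc t ∸ kept) * suc t  ≡⟨ cong (λ x → t + x * suc t) (m+n∸m≡n kept _) ⟩
    t + q / suc t * suc t                  ≡⟨ cong (_+ q / suc t * suc t) q%≡t ⟨
    q % suc t + q / suc t * suc t          ≡⟨ m≡m%n+[m/n]*n q (suc t) ⟨
    q                                      ∎
    where open ≡-Reasoning
  ... | no q%≢t = begin
    advance (narrow t q)                 ≡⟨ cong advance narrow≡ ⟩
    advance (b + a * t)                  ≡⟨ advance-kept (widened<n⇒<kept a b<t (subst (_< n) q≡ q<n)) ⟩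
    widen t (b + a * t)                  ≡⟨ widen-digits a b<t ⟩
    b + a * suc t                        ≡⟨ q≡ ⟨
    q                                    ∎
    where
    open ≡-Reasoning
    b = q % suc t
    a = q / suc t
    q≡ : q ≡ b + a * suc t
    q≡ = m≡m%n+[m/n]*n q (suc t)
    b<t : b < t
    b<t = ≤∧≢⇒< (s≤s⁻¹ (m%n<n q (suc t))) q%≢t
    narrow≡ : narrow t q ≡ b + a * t
    narrow≡ = trans (cong (narrow t) q≡) (narrow-digits a (m%n<n q (suc t)))

  advanceₚ : Permutation′ n
  advanceₚ = permutationℕ advance retreat advance-< retreat-< retreat-advance advance-retreat

best-≤ : ∀ {x xs} → x ∈ xs → best xs ≤ x
best-≤ {xs = y ∷ ys} = foldr-⊓-≤ y ys
  where
  foldr-⊓-≤ : ∀ {x} y ys → x ∈ y ∷ ys → foldr _⊓_ y ys ≤ x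
  foldr-⊓-≤ y []       (here refl)        = ≤-refl
  foldr-⊓-≤ y (z ∷ zs) (here refl)        = ≤-trans (m⊓n≤n z _) (foldr-⊓-≤ y zs (here refl))
  foldr-⊓-≤ y (z ∷ zs) (there (here refl)) = m⊓n≤m z _
  foldr-⊓-≤ y (z ∷ zs) (there (there x∈zs)) = ≤-trans (m⊓n≤n z _) (foldr-⊓-≤ y zs (there x∈zs))

∈-bundle : ∀ {n} (σ : AssignmentSeq n) i {s t} → toℕ s < t → itemOn σ s i ∈ bundle σ i t
∈-bundle σ i {s} {t} s<t = ∈-map⁺ (λ s → itemOn σ s i) (∈-filter⁺ (λ s → toℕ s <? t) (∈-allFin s) s<t)

<⌈/⌉ : ∀ {r n} t → r * suc t < n → r < ⌈ n / suc t ⌉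
<⌈/⌉ {r} {n} t r*t<n = *-≤⇒≤-/ (suc t) (begin
  suc r * suc t        ≡⟨ cong suc (+-comm t (r * suc t)) ⟩
  suc (r * suc t) + t  ≤⟨ +-monoˡ-≤ t r*t<n ⟩
  n + t                ≡⟨ cong (_∸ 1) (+-suc n t) ⟨
  n + suc t ∸ 1        ∎)
  where open ≤-Reasoning

module Schedule (n : ℕ) where

  open module Day (u : ℕ) = Advance n (suc u) using (kept; fresh; kept+fresh≡n; advance; advance-kept; advance-fresh; advanceₚ)

  -- layout u: the positions after the u + 1 days 0, …, u.
  layout : ℕ → Permutation′ n
  layout zero    = id
  layout (suc u) = layout u ∘ₚ advanceₚ u

  assignment : ℕ → Permutation′ n
  assignment zero    = id
  assignment (suc u) = layout u ∘ₚ rotateₚ (kept u) (fresh u) (kept+fresh≡n u)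

  record Witness (u : ℕ) (i : Fin n) : Set where
    field
      day rank : ℕ
      day≤u    : day ≤ u
      position : toℕ (layout u ⟨$⟩ʳ i) ≡ day + rank * suc u
      receives : toℕ (assignment day ⟨$⟩ʳ i) ≡ rank

  witness : ∀ u i → Witness u i
  witness zero i = record
    { day = 0 ; rank = toℕ i ; day≤u = z≤n ; position = sym (*-identityʳ (toℕ i)) ; receives = refl }
  witness (suc u) i with witness u i | toℕ (layout u ⟨$⟩ʳ i) <? kept u
  ... | w | yes p<kept = record
    { day      = day
    ; rank     = rank
    ; day≤u    = m≤n⇒m≤1+n day≤u
    ; position = begin
      toℕ (layout (suc u) ⟨$⟩ʳ i)         ≡⟨ toℕ-fromℕ< _ ⟩
      advance u p                         ≡⟨ advance-kept u p<kept ⟩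
      widen (suc u) p                     ≡⟨ cong (widen (suc u)) position ⟩
      widen (suc u) (day + rank * suc u)  ≡⟨ widen-digits rank (s≤s day≤u) ⟩
      day + rank * suc (suc u)            ∎
    ; receives = receives
    }
    where
    open Witness w
    open ≡-Reasoning
    p = toℕ (layout u ⟨$⟩ʳ i)
  ... | _ | no p≮kept = record
    { day      = suc u
    ; rank     = p ∸ kept u
    ; day≤u    = ≤-refl
    ; position = trans (toℕ-fromℕ< _) (advance-fresh u (≮⇒≥ p≮kept))
    ; receives = trans (toℕ-fromℕ< _) (rotate-≥ (fresh u) (≮⇒≥ p≮kept))
    }
    where
    p = toℕ (layout u ⟨$⟩ʳ i)

  schedule : AssignmentSeq n
  schedule d = ↔⇒⤖ (assignment (toℕ d))

  schedule-topBalanced : TopBalanced schedule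
  schedule-topBalanced d i = begin
    best (bundle schedule i (suc u))  ≤⟨ best-≤ (∈-bundle schedule i (s≤s toℕs≤u)) ⟩
    itemOn schedule s i               ≡⟨ cong suc (trans (cong (λ b → toℕ (assignment b ⟨$⟩ʳ i)) (toℕ-fromℕ< day<n)) receives) ⟩
    suc rank                          ≤⟨ <⌈/⌉ u (≤-<-trans (m≤n+m (rank * suc u) day) (subst (_< n) position (toℕ<n _))) ⟩
    ⌈ n / suc u ⌉                     ∎
    where
    open ≤-Reasoning
    u = toℕ d
    open Witness (witness u i)
    day<n : day < n
    day<n = ≤-<-trans day≤u (toℕ<n d)
    s : Fin n
    s = fromℕ< day<n
    toℕs≤u : toℕ s ≤ u
    toℕs≤u = subst (_≤ u) (sym (toℕ-fromℕ< day<n)) day≤u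

proposition1 : (n : ℕ) → .{{NonZero n}} → ∃ λ (σ : AssignmentSeq n) → TopBalanced σ
proposition1 n = Schedule.schedule n , Schedule.schedule-topBalanced n
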